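{- Let $k\ge 2$ be an integer and let $G$ be a connected, non-complete graph of order $n$ with $NC(G)\ge\frac{n-2}{2}$. Let $u$ be a vertex with $d_G(u)=\delta(G)$, let $N(u)=\{u_1,\dots,u_{\delta(G)}\}$ and $W=V(G)\setminus(N(u)\cup\{u\})$. If $\delta(G)<\frac{n-4k+4}{2}$, then the set $\{u_i\in N(u): |N_G(u_i)\cap W|\le k-1\}$ is a clique of $G$.
   Context: All graphs are finite and simple. $\delta(G)$ is the minimum degree and $d_G(x)$ the degree of $x$; $N_G(x)$ is the neighbourhood of $x$. For a non-complete graph $G$, $NC(G)=\min\{|N_G(x)\cup N_G(y)| : x,y\in V(G),\ x\ne y,\ xy\notin E(G)\}$. -}

module Defs where

open import Data.Nat using (ℕ; suc; _≤_)
open import Data.Bool using (Bool; true; false; if_then_else_)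
open import Data.Fin using (Fin)
open import Data.Fin.Subset using (Subset; inside; outside; ∣_∣; _∪_; _∩_; ∁; ⁅_⁆; _∈_)
open import Data.Vec using (tabulate)
open import Data.Product using (Σ; _×_)
open import Relation.Binary.PropositionalEquality using (_≡_; _≢_)
open import Relation.Nullary using (¬_)

record Graph (n : ℕ) : Set where
  field
    adj    : Fin n → Fin n → Bool
    sym    : ∀ x y → adj x y ≡ adj y x
    irrefl : ∀ x → adj x x ≡ false
open Graph public

Adj : ∀ {n} → Graph n → Fin n → Fin n → Set
Adj G x y = adj G x y ≡ true

N : ∀ {n} → Graph n → Fin n → Subset n
N G x = tabulate (λ y → if adj G x y then inside else outside)

deg : ∀ {n} → Graph n → Fin n → ℕ
deg G x = ∣ N G x ∣

data Reach {n} (G : Graph n) : Fin n → Fin n → Set where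
  here : ∀ {x} → Reach G x x
  step : ∀ {x y z} → Adj G x y → Reach G y z → Reach G x z

Connected : ∀ {n} → Graph n → Set
Connected G = ∀ x y → Reach G x y

NonComplete : ∀ {n} → Graph n → Set
NonComplete {n} G = Σ (Fin n) λ x → Σ (Fin n) λ y → x ≢ y × ¬ Adj G x y

IsMinDegVertex : ∀ {n} → Graph n → Fin n → Set
IsMinDegVertex G u = ∀ v → deg G u ≤ deg G v

W : ∀ {n} → Graph n → Fin n → Subset n
W G u = ∁ (N G u ∪ ⁅ u ⁆)

{-# OPTIONS --safe #-}
-- If two such neighbours x, y of u were non-adjacent, every vertex of N(x) ∪ N(y)
-- lies in N(u) ∖ {x, y}, is u, or is one of the at most 2(k − 1) neighbours of x
-- or y in W; so |N(x) ∪ N(y)| ≤ δ + 2k − 3, and NC(G) ≥ (n − 2)/2 then forces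
-- 2δ ≥ n − 4k + 4.
module Submission where

open import Defs hiding (sym)
open import Data.Nat using (ℕ; suc; _+_; _*_; _≤_; _<_; z≤n; s≤s)
open import Data.Nat.Properties
open import Data.Nat.Solver using (module +-*-Solver)
open import Data.Bool using (true; false; if_then_else_) renaming (_≟_ to _≟ᵇ_)
open import Data.Fin using (Fin) renaming (_≟_ to _≟ᶠ_)
open import Data.Fin.Subset using (Subset; inside; outside; ∣_∣; _∪_; _∩_; _∈_; _-_; ⁅_⁆; _⊆_)
open import Data.Fin.Subset.Properties
open import Data.Vec using (_∷_; [])
open import Data.Vec.Properties using ([]=⇒lookup; lookup∘tabulate)
open import Data.Sum using (_⊎_; inj₁; inj₂; [_,_])
open import Data.Product using (_,_)
open import Function using (_∘_)
open import Relation.Binary.PropositionalEquality using (_≡_; refl; sym; trans; cong; _≢_)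
open import Relation.Nullary using (¬_; yes; no)
open import Relation.Nullary.Decidable using (decidable-stable)

∣p∪q∣≤∣p∣+∣q∣ : ∀ {n} (p q : Subset n) → ∣ p ∪ q ∣ ≤ ∣ p ∣ + ∣ q ∣
∣p∪q∣≤∣p∣+∣q∣ []            []            = z≤n
∣p∪q∣≤∣p∣+∣q∣ (inside  ∷ p) (inside  ∷ q) = s≤s (≤-trans (∣p∪q∣≤∣p∣+∣q∣ p q) (+-monoʳ-≤ ∣ p ∣ (n≤1+n ∣ q ∣)))
∣p∪q∣≤∣p∣+∣q∣ (inside  ∷ p) (outside ∷ q) = s≤s (∣p∪q∣≤∣p∣+∣q∣ p q)
∣p∪q∣≤∣p∣+∣q∣ (outside ∷ p) (inside  ∷ q) = ≤-trans (s≤s (∣p∪q∣≤∣p∣+∣q∣ p q)) (≤-reflexive (sym (+-suc ∣ p ∣ ∣ q ∣)))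
∣p∪q∣≤∣p∣+∣q∣ (outside ∷ p) (outside ∷ q) = ∣p∪q∣≤∣p∣+∣q∣ p q

2+∣p-x-y∣≤∣p∣ : ∀ {n} {p : Subset n} {x y} → x ∈ p → y ∈ p → x ≢ y → 2 + ∣ p - x - y ∣ ≤ ∣ p ∣
2+∣p-x-y∣≤∣p∣ x∈p y∈p x≢y =
  ≤-trans (s≤s (x∈p⇒∣p-x∣<∣p∣ (x∈p∧x≢y⇒x∈p-y y∈p (x≢y ∘ sym)))) (x∈p⇒∣p-x∣<∣p∣ x∈p)

module _ {n} (G : Graph n) where

  Adj-sym : ∀ {x y} → Adj G x y → Adj G y x
  Adj-sym {x} {y} xy = trans (Graph.sym G y x) xy

  ∈N⇒Adj : ∀ {x y} → y ∈ N G x → Adj G x y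
  ∈N⇒Adj {x} {y} y∈Nx = inside⇒true (trans (sym (lookup∘tabulate _ y)) ([]=⇒lookup y∈Nx))
    where
    inside⇒true : ∀ {b} → (if b then inside else outside) ≡ inside → b ≡ true
    inside⇒true {true}  _ = refl
    inside⇒true {false} ()

  ∈N⇒≢ : ∀ {x z} → z ∈ N G x → z ≢ x
  ∈N⇒≢ {x} x∈Nx refl with () ← trans (sym (∈N⇒Adj x∈Nx)) (irrefl G x)

  ∈N∧¬Adj⇒≢ : ∀ {x y z} → ¬ Adj G x y → z ∈ N G y → z ≢ x
  ∈N∧¬Adj⇒≢ ¬xy x∈Ny refl = ¬xy (Adj-sym (∈N⇒Adj x∈Ny))

  ∈N⊎≡⊎∈W : ∀ u z → z ∈ N G u ⊎ z ≡ u ⊎ z ∈ W G u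
  ∈N⊎≡⊎∈W u z with z ∈? N G u | z ≟ᶠ u
  ... | yes z∈Nu | _        = inj₁ z∈Nu
  ... | no  _    | yes z≡u  = inj₂ (inj₁ z≡u)
  ... | no  z∉Nu | no  z≢u  = inj₂ (inj₂ (x∉p⇒x∈∁p ([ z∉Nu , z≢u ∘ x∈⁅y⁆⇒x≡y u ] ∘ x∈p∪q⁻ _ _)))

  N∪N⊆ : ∀ {u x y} → ¬ Adj G x y →
    N G x ∪ N G y ⊆ (N G u - x - y) ∪ (⁅ u ⁆ ∪ (N G x ∩ W G u ∪ N G y ∩ W G u))
  N∪N⊆ {u} {x} {y} ¬xy {z} z∈A with x∈p∪q⁻ (N G x) (N G y) z∈A | ∈N⊎≡⊎∈W u z
  ... | z∈N | inj₁ z∈Nu = x∈p∪q⁺ (inj₁ (x∈p∧x≢y⇒x∈p-y (x∈p∧x≢y⇒x∈p-y z∈Nu (≢x z∈N)) (≢y z∈N)))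
    where
    ≢x : z ∈ N G x ⊎ z ∈ N G y → z ≢ x
    ≢x (inj₁ z∈Nx) = ∈N⇒≢ z∈Nx
    ≢x (inj₂ z∈Ny) = ∈N∧¬Adj⇒≢ ¬xy z∈Ny
    ≢y : z ∈ N G x ⊎ z ∈ N G y → z ≢ y
    ≢y (inj₁ z∈Nx) = ∈N∧¬Adj⇒≢ (¬xy ∘ Adj-sym) z∈Nx
    ≢y (inj₂ z∈Ny) = ∈N⇒≢ z∈Ny
  ... | _           | inj₂ (inj₁ refl) = x∈p∪q⁺ (inj₂ (x∈p∪q⁺ (inj₁ (x∈⁅x⁆ u))))
  ... | inj₁ z∈Nx   | inj₂ (inj₂ z∈W)  = x∈p∪q⁺ (inj₂ (x∈p∪q⁺ (inj₂ (x∈p∪q⁺ (inj₁ (x∈p∩q⁺ (z∈Nx , z∈W)))))))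
  ... | inj₂ z∈Ny   | inj₂ (inj₂ z∈W)  = x∈p∪q⁺ (inj₂ (x∈p∪q⁺ (inj₂ (x∈p∪q⁺ (inj₂ (x∈p∩q⁺ (z∈Ny , z∈W)))))))

  ∣N∪N∣<deg+∣N∩W∣+∣N∩W∣ : ∀ {u x y} → x ∈ N G u → y ∈ N G u → x ≢ y → ¬ Adj G x y →
    ∣ N G x ∪ N G y ∣ < deg G u + ∣ N G x ∩ W G u ∣ + ∣ N G y ∩ W G u ∣
  ∣N∪N∣<deg+∣N∩W∣+∣N∩W∣ {u} {x} {y} x∈Nu y∈Nu x≢y ¬xy = begin-strict
    ∣ N G x ∪ N G y ∣                               ≤⟨ p⊆q⇒∣p∣≤∣q∣ (N∪N⊆ {u} ¬xy) ⟩
    ∣ (N G u - x - y) ∪ (⁅ u ⁆ ∪ (Wx ∪ Wy)) ∣       ≤⟨ ∣p∪q∣≤∣p∣+∣q∣ (N G u - x - y) _ ⟩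
    e + ∣ ⁅ u ⁆ ∪ (Wx ∪ Wy) ∣                       ≤⟨ +-monoʳ-≤ e (∣p∪q∣≤∣p∣+∣q∣ ⁅ u ⁆ _) ⟩
    e + (∣ ⁅ u ⁆ ∣ + ∣ Wx ∪ Wy ∣)                   ≡⟨ cong (λ s → e + (s + ∣ Wx ∪ Wy ∣)) (∣⁅x⁆∣≡1 u) ⟩
    e + suc ∣ Wx ∪ Wy ∣                             ≤⟨ +-monoʳ-≤ e (s≤s (∣p∪q∣≤∣p∣+∣q∣ Wx Wy)) ⟩
    e + suc (∣ Wx ∣ + ∣ Wy ∣)                       ≡⟨ +-suc e _ ⟩
    suc e + (∣ Wx ∣ + ∣ Wy ∣)                       <⟨ +-monoˡ-< (∣ Wx ∣ + ∣ Wy ∣) (2+∣p-x-y∣≤∣p∣ {p = N G u} x∈Nu y∈Nu x≢y) ⟩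
    deg G u + (∣ Wx ∣ + ∣ Wy ∣)                     ≡⟨ sym (+-assoc (deg G u) _ _) ⟩
    deg G u + ∣ Wx ∣ + ∣ Wy ∣                       ∎
    where
    open ≤-Reasoning
    Wx Wy : Subset n
    Wx = N G x ∩ W G u
    Wy = N G y ∩ W G u
    e : ℕ
    e = ∣ N G u - x - y ∣

lemma2p2 : (k n : ℕ) → 2 ≤ k → (G : Graph n) → Connected G → NonComplete G
    → (∀ x y → x ≢ y → ¬ Adj G x y → n ≤ 2 * ∣ N G x ∪ N G y ∣ + 2)
    → (u : Fin n) → IsMinDegVertex G u
    → 2 * deg G u + 4 * k < n + 4
    → ∀ x y → x ∈ N G u → y ∈ N G u
    → ∣ N G x ∩ W G u ∣ < k → ∣ N G y ∩ W G u ∣ < k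
    → x ≢ y → Adj G x y
lemma2p2 k n _ G _ _ NC u _ δ-small x y x∈Nu y∈Nu ∣Wx∣<k ∣Wy∣<k x≢y =
  decidable-stable (adj G x y ≟ᵇ true) λ ¬xy → <⇒≱ δ-small
    (n+4≤2d+4k (NC x y x≢y ¬xy) (∣N∪N∣<deg+∣N∩W∣+∣N∩W∣ G x∈Nu y∈Nu x≢y ¬xy) ∣Wx∣<k ∣Wy∣<k)
  where
  n+4≤2d+4k : ∀ {m d a b} → n ≤ 2 * m + 2 → m < d + a + b → a < k → b < k → n + 4 ≤ 2 * d + 4 * k
  n+4≤2d+4k {m} {d} {a} {b} n≤2m+2 m<d+a+b a<k b<k = begin
    n + 4                      ≤⟨ +-monoˡ-≤ 4 n≤2m+2 ⟩
    2 * m + 2 + 4              ≡⟨ solve 1 (λ m → con 2 :* m :+ con 2 :+ con 4 := con 2 :* (con 1 :+ m) :+ con 4) refl m ⟩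
    2 * suc m + 4              ≤⟨ +-monoˡ-≤ 4 (*-monoʳ-≤ 2 m<d+a+b) ⟩
    2 * (d + a + b) + 4        ≡⟨ solve 3 (λ d a b → con 2 :* (d :+ a :+ b) :+ con 4 := con 2 :* (d :+ (con 1 :+ a) :+ (con 1 :+ b))) refl d a b ⟩
    2 * (d + suc a + suc b)    ≤⟨ *-monoʳ-≤ 2 (+-mono-≤ (+-monoʳ-≤ d a<k) b<k) ⟩
    2 * (d + k + k)            ≡⟨ solve 2 (λ d k → con 2 :* (d :+ k :+ k) := con 2 :* d :+ con 4 :* k) refl d k ⟩
    2 * d + 4 * k              ∎
    where
    open ≤-Reasoning
    open +-*-Solver
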